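{- Let $n$ be a positive integer. In the graph $R_n$ the fall-down transformation $T$ is monotone: for every $S\subseteq\{1,\dots,n\}^2$, $|\partial_{R_n}T(S)|\le|\partial_{R_n}S|$.
   Context: $S_n$ is the $n\times n$ square grid graph with vertex set $\{1,\dots,n\}^2$ (first coordinate = column, increasing to the right; second = row, increasing upward), where $(x,y)$ and $(x',y')$ are adjacent iff $(x'-x,y'-y)\in\{(\pm1,0),(0,\pm1)\}$. $R_n$ has the same vertex set, with all edges of $S_n$ plus the diagonal edges joining $(x,y+1)$ and $(x+1,y)$ for $1\le x,y\le n-1$ (the triangulated rhombus). For a graph $H$ on this vertex set and $A\subseteq\{1,\dots,n\}^2$, $\partial_H A=\{v\in A: v \text{ is adjacent in } H \text{ to some } u\notin A\}$. Fall-down transformation: for $S\subseteq\{1,\dots,n\}^2$, let $c_x=|\{y:(x,y)\in S\}|$ and $S'=\{(x,y): 1\le y\le c_x\}$ (push each column down); then let $r_y=|\{x:(x,y)\in S'\}|$ and $T(S)=\{(x,y): 1\le x\le r_y\}$ (push each row to the left). -}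

module Defs where

open import Data.Nat using (ℕ; zero; suc; _+_; _<ᵇ_; _≡ᵇ_)
open import Data.Bool using (Bool; true; false; _∧_; _∨_; not; if_then_else_)
open import Data.Fin using (Fin; toℕ)
open import Data.List using (List; map; allFin)
open import Data.Bool.ListAction using (any)
open import Data.Nat.ListAction using (sum)

-- Vertices of the n×n grid: pairs (x , y) of Fin n; Fin value i stands
-- for coordinate i+1.  x = column (increasing right), y = row (upward).
Subset² : ℕ → Set
Subset² n = Fin n → Fin n → Bool

countFin : ∀ {n} → (Fin n → Bool) → ℕ
countFin {n} p = sum (map (λ i → if p i then 1 else 0) (allFin n))

card² : ∀ {n} → Subset² n → ℕ
card² {n} A = sum (map (λ x → countFin (λ y → A x y)) (allFin n))

adjS : ℕ → ℕ → ℕ → ℕ → Bool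
adjS x y x' y' =
     ((x' ≡ᵇ suc x) ∧ (y' ≡ᵇ y))
  ∨ ((x ≡ᵇ suc x') ∧ (y ≡ᵇ y'))
  ∨ ((x' ≡ᵇ x) ∧ (y' ≡ᵇ suc y))
  ∨ ((x' ≡ᵇ x) ∧ (y ≡ᵇ suc y'))

adjR : ℕ → ℕ → ℕ → ℕ → Bool
adjR x y x' y' =
     adjS x y x' y'
  ∨ ((x' ≡ᵇ suc x) ∧ (y ≡ᵇ suc y'))
  ∨ ((x ≡ᵇ suc x') ∧ (y' ≡ᵇ suc y))

∂R : ∀ {n} → Subset² n → Subset² n
∂R {n} A x y =
  A x y ∧ any (λ x' → any (λ y' →
            adjR (toℕ x) (toℕ y) (toℕ x') (toℕ y') ∧ not (A x' y'))
          (allFin n)) (allFin n)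

pushDown : ∀ {n} → Subset² n → Subset² n
pushDown S x y = toℕ y <ᵇ countFin (λ y' → S x y')

pushLeft : ∀ {n} → Subset² n → Subset² n
pushLeft S x y = toℕ x <ᵇ countFin (λ x' → S x' y)

fallDown : ∀ {n} → Subset² n → Subset² n
fallDown S = pushLeft (pushDown S)

-- The fall-down set T(S) is a staircase: closed downwards in every column and
-- leftwards in every row.  For a staircase, a missing diagonal neighbour forces a
-- missing horizontal or vertical one, so its R_n-boundary is its S_n-boundary.
-- It therefore suffices that pushing columns down (and, transposed, rows left)
-- does not enlarge the S_n-boundary, which already holds column by column: if
-- column x has c cells, L of them on the boundary, then every boundary cell of
-- the pushed column lies in rows c − L, …, c − 1 (counting from 0).  An exit to a
-- neighbouring column x' at height y gives c ≤ L + c_{x'} ≤ L + y, and an exit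
-- upwards from the top cell means 0 < c < n, so the original column switches
-- between S and its complement somewhere and L ≥ 1.

module Submission where

open import Defs
open import Data.Nat using (ℕ; zero; suc; pred; _+_; _∸_; _≤_; _<_; _≡ᵇ_; z≤n; s≤s; s≤s⁻¹)
open import Data.Nat.Properties
open import Data.Bool using (Bool; true; false; T; _∧_; _∨_; not; if_then_else_)
open import Data.Bool.Properties using (T-≡; T-not-≡; T-∧; T-∨)
  renaming (_≟_ to _≟ᵇ_)
open import Data.Fin using (Fin; toℕ) renaming (zero to fzero; suc to fsuc)
open import Data.Fin.Properties using (toℕ-injective; toℕ<n)
open import Data.List using (map; allFin; tabulate)
open import Data.List.Properties using (map-tabulate)
import Data.Nat.ListAction as List
open import Data.Bool.ListAction using (any)
open import Data.List.Relation.Unary.Any using (satisfied)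
open import Data.List.Relation.Unary.Any.Properties using (any⁺; any⁻)
open import Data.List.Membership.Propositional using (lose)
open import Data.List.Membership.Propositional.Properties using (∈-allFin)
open import Algebra.Properties.CommutativeMonoid.Sum +-0-commutativeMonoid
  using (sum-syntax; sum-cong-≗; ∑-distrib-+; ∑-comm)
open import Data.Product using (_×_; _,_; ∃-syntax; ∃₂; uncurry)
open import Data.Sum using (_⊎_; inj₁; inj₂)
open import Data.Empty using (⊥-elim)
open import Data.Unit using (tt)
open import Function using (_∘_; id; Equivalence)
open import Relation.Nullary using (¬_; yes; no)
open import Relation.Binary.PropositionalEquality

T-not-contraposition : ∀ {a b} → (T a → T b) → T (not b) → T (not a)
T-not-contraposition {false}         _   _ = tt
T-not-contraposition {true} {false} a⇒b _ = a⇒b tt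

T-not⇒¬T : ∀ {a} → T (not a) → ¬ T a
T-not⇒¬T {true} () _

T∧T-not⇒≢ : ∀ {a b} → T a → T (not b) → a ≢ b
T∧T-not⇒≢ {true} {false} _ _ ()

T-≡ᵇ∧≡ᵇ⇒≡×≡ : ∀ {a b c d} → T ((a ≡ᵇ b) ∧ (c ≡ᵇ d)) → a ≡ b × c ≡ d
T-≡ᵇ∧≡ᵇ⇒≡×≡ {a} {b} {c} {d} t with Equivalence.to T-∧ t
... | a≡ᵇb , c≡ᵇd = ≡ᵇ⇒≡ a b a≡ᵇb , ≡ᵇ⇒≡ c d c≡ᵇd

≡×≡⇒T-≡ᵇ∧≡ᵇ : ∀ {a b c d} → a ≡ b → c ≡ d → T ((a ≡ᵇ b) ∧ (c ≡ᵇ d))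
≡×≡⇒T-≡ᵇ∧≡ᵇ {a} {b} {c} {d} a≡b c≡d = Equivalence.from T-∧ (≡⇒≡ᵇ a b a≡b , ≡⇒≡ᵇ c d c≡d)

T-∨ˡ : ∀ {a b} → T a → T (a ∨ b)
T-∨ˡ = Equivalence.from T-∨ ∘ inj₁

-- The left disjunct is explicit: it cannot be inferred through a stuck _∨_.
T-∨ʳ : ∀ a {b} → T b → T (a ∨ b)
T-∨ʳ a = Equivalence.from (T-∨ {a}) ∘ inj₂

∑-mono-≤ : ∀ {m} {f g : Fin m → ℕ} → (∀ i → f i ≤ g i) → ∑[ i < m ] f i ≤ ∑[ i < m ] g i
∑-mono-≤ {zero}  _   = z≤n
∑-mono-≤ {suc m} f≤g = +-mono-≤ (f≤g fzero) (∑-mono-≤ (f≤g ∘ fsuc))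

sum-tabulate : ∀ {m} (f : Fin m → ℕ) → List.sum (tabulate f) ≡ ∑[ i < m ] f i
sum-tabulate {zero}  f = refl
sum-tabulate {suc m} f = cong (f fzero +_) (sum-tabulate (f ∘ fsuc))

sum-map-allFin : ∀ {m} (f : Fin m → ℕ) → List.sum (map f (allFin m)) ≡ ∑[ i < m ] f i
sum-map-allFin f = trans (cong List.sum (map-tabulate id f)) (sum-tabulate f)

count : ∀ {m} → (Fin m → Bool) → ℕ
count {m} p = ∑[ i < m ] (if p i then 1 else 0)

countFin≡count : ∀ {m} (p : Fin m → Bool) → countFin p ≡ count p
countFin≡count p = sum-map-allFin (λ i → if p i then 1 else 0)

count-mono : ∀ {m} {p q : Fin m → Bool} → (∀ i → T (p i) → T (q i)) → count p ≤ count q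
count-mono p⇒q = ∑-mono-≤ (λ i → indicator-mono (p⇒q i))
  where
  indicator-mono : ∀ {a b} → (T a → T b) → (if a then 1 else 0) ≤ (if b then 1 else 0)
  indicator-mono {false}         _   = z≤n
  indicator-mono {true} {true}   _   = ≤-refl
  indicator-mono {true} {false} a⇒b = ⊥-elim (a⇒b tt)

count≤count∖+count : ∀ {m} (p q : Fin m → Bool) →
  count p ≤ count (λ i → p i ∧ not (q i)) + count q
count≤count∖+count p q = ≤-trans (∑-mono-≤ (λ i → indicator-split (p i) (q i)))
  (≤-reflexive (∑-distrib-+ (λ i → if p i ∧ not (q i) then 1 else 0) (λ i → if q i then 1 else 0)))
  where
  indicator-split : ∀ a b → (if a then 1 else 0) ≤ (if a ∧ not b then 1 else 0) + (if b then 1 else 0)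
  indicator-split false _     = z≤n
  indicator-split true  false = ≤-refl
  indicator-split true  true  = ≤-refl

T⇒0<count : ∀ {m} (p : Fin m → Bool) i → T (p i) → 0 < count p
T⇒0<count p fzero    pᵢ with p fzero
... | true = s≤s z≤n
T⇒0<count p (fsuc i) pᵢ = <-≤-trans (T⇒0<count (p ∘ fsuc) i pᵢ) (m≤n+m _ _)

0<count⇒∃ : ∀ {m} (p : Fin m → Bool) → 0 < count p → ∃[ i ] T (p i)
0<count⇒∃ {suc m} p 0<count with p fzero in p₀
... | true  = fzero , Equivalence.from T-≡ p₀
... | false with 0<count⇒∃ (p ∘ fsuc) 0<count
...   | i , pᵢ = fsuc i , pᵢ

count<m⇒∃¬ : ∀ {m} (p : Fin m → Bool) → count p < m → ∃[ i ] T (not (p i))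
count<m⇒∃¬ {suc m} p count<m with p fzero in p₀
... | false = fzero , Equivalence.from T-not-≡ p₀
... | true with count<m⇒∃¬ (p ∘ fsuc) (s≤s⁻¹ count<m)
...   | i , ¬pᵢ = fsuc i , ¬pᵢ

count≤width : ∀ {m} (p : Fin m → Bool) lo hi →
  (∀ i → T (p i) → lo ≤ toℕ i × toℕ i < hi) → count p ≤ hi ∸ lo
count≤width {zero}  p lo hi _      = z≤n
count≤width {suc m} p lo hi bounds =
  ≤-trans (+-monoʳ-≤ _ (count≤width (p ∘ fsuc) (pred lo) (pred hi) shifted))
          (first-step (p fzero) lo hi (bounds fzero))
  where
  shifted : ∀ i → T (p (fsuc i)) → pred lo ≤ toℕ i × toℕ i < pred hi
  shifted i pᵢ with bounds (fsuc i) pᵢ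
  ... | lo≤1+i , 1+i<hi = pred-mono-≤ lo≤1+i , pred-mono-< 1+i<hi

  first-step : ∀ b lo hi → (T b → lo ≤ 0 × 0 < hi) →
    (if b then 1 else 0) + (pred hi ∸ pred lo) ≤ hi ∸ lo
  first-step false zero    hi      _ = pred[n]≤n
  first-step false (suc l) zero    _ = ≤-reflexive (0∸n≡0 l)
  first-step false (suc l) (suc h) _ = ≤-refl
  first-step true  lo      hi      b⇒ with b⇒ tt
  ... | z≤n , s≤s _ = ≤-refl

_⊆²_ : ∀ {n} → Subset² n → Subset² n → Set
A ⊆² B = ∀ x y → T (A x y) → T (B x y)

transpose : ∀ {n} → Subset² n → Subset² n
transpose A x y = A y x

card²≡∑count : ∀ {n} (A : Subset² n) → card² A ≡ ∑[ x < n ] count (A x)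
card²≡∑count A =
  trans (sum-map-allFin (λ x → countFin (A x))) (sum-cong-≗ (λ x → countFin≡count (A x)))

card²-mono-columns : ∀ {n} {A B : Subset² n} →
  (∀ x → count (A x) ≤ count (B x)) → card² A ≤ card² B
card²-mono-columns {A = A} {B} A≤B =
  subst₂ _≤_ (sym (card²≡∑count A)) (sym (card²≡∑count B)) (∑-mono-≤ A≤B)

card²-mono : ∀ {n} {A B : Subset² n} → A ⊆² B → card² A ≤ card² B
card²-mono A⊆B = card²-mono-columns (λ x → count-mono (A⊆B x))

card²-transpose : ∀ {n} (A : Subset² n) → card² (transpose A) ≡ card² A
card²-transpose {n} A = begin
  card² (transpose A)                             ≡⟨ card²≡∑count (transpose A) ⟩
  ∑[ y < n ] ∑[ x < n ] (if A x y then 1 else 0)  ≡⟨ ∑-comm (λ y x → if A x y then 1 else 0) ⟩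
  ∑[ x < n ] ∑[ y < n ] (if A x y then 1 else 0)  ≡⟨ card²≡∑count A ⟨
  card² A                                         ∎
  where open ≡-Reasoning

data SquareStep (x y x' y' : ℕ) : Set where
  right : x' ≡ suc x → y' ≡ y → SquareStep x y x' y'
  left  : x ≡ suc x' → y ≡ y' → SquareStep x y x' y'
  up    : x' ≡ x → y' ≡ suc y → SquareStep x y x' y'
  down  : x' ≡ x → y ≡ suc y' → SquareStep x y x' y'

data DiagonalStep (x y x' y' : ℕ) : Set where
  downRight : x' ≡ suc x → y ≡ suc y' → DiagonalStep x y x' y'
  upLeft    : x ≡ suc x' → y' ≡ suc y → DiagonalStep x y x' y'

SquareStep-transpose : ∀ {x y x' y'} → SquareStep x y x' y' → SquareStep y x y' x'
SquareStep-transpose (right p q) = up q p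
SquareStep-transpose (left p q)  = down (sym q) p
SquareStep-transpose (up p q)    = right q p
SquareStep-transpose (down p q)  = left q (sym p)

adjS⇒SquareStep : ∀ x y x' y' → T (adjS x y x' y') → SquareStep x y x' y'
adjS⇒SquareStep x y x' y' adj with Equivalence.to T-∨ adj
... | inj₁ r = uncurry right (T-≡ᵇ∧≡ᵇ⇒≡×≡ r)
... | inj₂ adj with Equivalence.to T-∨ adj
...   | inj₁ l = uncurry left (T-≡ᵇ∧≡ᵇ⇒≡×≡ l)
...   | inj₂ adj with Equivalence.to T-∨ adj
...     | inj₁ u = uncurry up (T-≡ᵇ∧≡ᵇ⇒≡×≡ u)
...     | inj₂ d = uncurry down (T-≡ᵇ∧≡ᵇ⇒≡×≡ d)

SquareStep⇒adjS : ∀ {x y x' y'} → SquareStep x y x' y' → T (adjS x y x' y')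
SquareStep⇒adjS (right p q) = T-∨ˡ (≡×≡⇒T-≡ᵇ∧≡ᵇ p q)
SquareStep⇒adjS {x} {y} {x'} {y'} (left p q) =
  T-∨ʳ ((x' ≡ᵇ suc x) ∧ (y' ≡ᵇ y)) (T-∨ˡ (≡×≡⇒T-≡ᵇ∧≡ᵇ p q))
SquareStep⇒adjS {x} {y} {x'} {y'} (up p q) =
  T-∨ʳ ((x' ≡ᵇ suc x) ∧ (y' ≡ᵇ y)) (T-∨ʳ ((x ≡ᵇ suc x') ∧ (y ≡ᵇ y'))
    (T-∨ˡ (≡×≡⇒T-≡ᵇ∧≡ᵇ p q)))
SquareStep⇒adjS {x} {y} {x'} {y'} (down p q) =
  T-∨ʳ ((x' ≡ᵇ suc x) ∧ (y' ≡ᵇ y)) (T-∨ʳ ((x ≡ᵇ suc x') ∧ (y ≡ᵇ y'))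
    (T-∨ʳ ((x' ≡ᵇ x) ∧ (y' ≡ᵇ suc y)) (≡×≡⇒T-≡ᵇ∧≡ᵇ p q)))

adjR⇒Step : ∀ x y x' y' → T (adjR x y x' y') → SquareStep x y x' y' ⊎ DiagonalStep x y x' y'
adjR⇒Step x y x' y' adj with Equivalence.to T-∨ adj
... | inj₁ s = inj₁ (adjS⇒SquareStep x y x' y' s)
... | inj₂ adj with Equivalence.to T-∨ adj
...   | inj₁ dr = inj₂ (uncurry downRight (T-≡ᵇ∧≡ᵇ⇒≡×≡ dr))
...   | inj₂ ul = inj₂ (uncurry upLeft (T-≡ᵇ∧≡ᵇ⇒≡×≡ ul))

Adjacency : Set
Adjacency = ℕ → ℕ → ℕ → ℕ → Bool

boundary : ∀ {n} → Adjacency → Subset² n → Subset² n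
boundary {n} adj A x y =
  A x y ∧ any (λ x' → any (λ y' →
            adj (toℕ x) (toℕ y) (toℕ x') (toℕ y') ∧ not (A x' y'))
          (allFin n)) (allFin n)

∂S : ∀ {n} → Subset² n → Subset² n
∂S = boundary adjS

record Escape {n} (Step : ℕ → ℕ → ℕ → ℕ → Set) (A : Subset² n) (x y : Fin n) : Set where
  constructor escapeTo
  field
    x' y'   : Fin n
    step    : Step (toℕ x) (toℕ y) (toℕ x') (toℕ y')
    outside : T (not (A x' y'))

Escape-map : ∀ {n} {P Q : ℕ → ℕ → ℕ → ℕ → Set} {A : Subset² n} {x y} →
  (∀ {a b a' b'} → P a b a' b' → Q a b a' b') → Escape P A x y → Escape Q A x y
Escape-map P⇒Q (escapeTo x' y' step ∉A) = escapeTo x' y' (P⇒Q step) ∉A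

module _ {n} (adj : Adjacency) {A : Subset² n} where

  boundary-intro : ∀ x y → T (A x y) → Escape (λ a b a' b' → T (adj a b a' b')) A x y →
    T (boundary adj A x y)
  boundary-intro x y ∈A (escapeTo x' y' step ∉A) = Equivalence.from T-∧ (∈A ,
    any⁺ _ (lose (∈-allFin x') (any⁺ _ (lose (∈-allFin y') (Equivalence.from T-∧ (step , ∉A))))))

  boundary-elim : ∀ x y → T (boundary adj A x y) →
    T (A x y) × Escape (λ a b a' b' → T (adj a b a' b')) A x y
  boundary-elim x y ∈∂A with Equivalence.to T-∧ ∈∂A
  ... | ∈A , escapes with satisfied (any⁻ _ (allFin n) escapes)
  ...   | x' , escapes with satisfied (any⁻ _ (allFin n) escapes)
  ...     | y' , step∧∉A = ∈A , uncurry (escapeTo x' y') (Equivalence.to T-∧ step∧∉A)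

∂S-intro : ∀ {n} {A : Subset² n} x y → T (A x y) → Escape SquareStep A x y → T (∂S A x y)
∂S-intro x y ∈A escape =
  boundary-intro adjS x y ∈A (Escape-map SquareStep⇒adjS escape)

∂S-elim : ∀ {n} {A : Subset² n} x y → T (∂S A x y) → T (A x y) × Escape SquareStep A x y
∂S-elim x y ∈∂A with boundary-elim adjS x y ∈∂A
... | ∈A , escape = ∈A , Escape-map (adjS⇒SquareStep _ _ _ _) escape

∂R-elim : ∀ {n} {A : Subset² n} x y → T (∂R A x y) →
  T (A x y) × Escape (λ a b a' b' → SquareStep a b a' b' ⊎ DiagonalStep a b a' b') A x y
∂R-elim x y ∈∂A with boundary-elim adjR x y ∈∂A
... | ∈A , escape = ∈A , Escape-map (adjR⇒Step _ _ _ _) escape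

∂S⊆∂R : ∀ {n} {A : Subset² n} → ∂S A ⊆² ∂R A
∂S⊆∂R x y ∈∂A with boundary-elim adjS x y ∈∂A
... | ∈A , escape =
  boundary-intro adjR x y ∈A (Escape-map (λ {a} {b} {a'} {b'} → T-∨ˡ {adjS a b a' b'}) escape)

∂S-transpose : ∀ {n} {A : Subset² n} → ∂S (transpose A) ⊆² transpose (∂S A)
∂S-transpose x y ∈∂A with ∂S-elim x y ∈∂A
... | ∈A , escapeTo x' y' step ∉A =
  ∂S-intro y x ∈A (escapeTo y' x' (SquareStep-transpose step) ∉A)

DownClosed : ∀ {n} → Subset² n → Set
DownClosed A = ∀ x {y y'} → toℕ y' ≤ toℕ y → T (A x y) → T (A x y')

LeftClosed : ∀ {n} → Subset² n → Set
LeftClosed A = DownClosed (transpose A)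

∂R⊆∂S : ∀ {n} {A : Subset² n} → DownClosed A → LeftClosed A → ∂R A ⊆² ∂S A
∂R⊆∂S downClosed leftClosed x y ∈∂A with ∂R-elim x y ∈∂A
... | ∈A , escapeTo x' y' (inj₁ step) ∉A = ∂S-intro x y ∈A (escapeTo x' y' step ∉A)
... | ∈A , escapeTo x' y' (inj₂ (downRight x'≡1+x y≡1+y')) ∉A =
  ∂S-intro x y ∈A (escapeTo x' y (right x'≡1+x refl)
    (T-not-contraposition (downClosed x' (<⇒≤ (≤-reflexive (sym y≡1+y')))) ∉A))
... | ∈A , escapeTo x' y' (inj₂ (upLeft x≡1+x' y'≡1+y)) ∉A =
  ∂S-intro x y ∈A (escapeTo x y' (up refl y'≡1+y)
    (T-not-contraposition (leftClosed y' (<⇒≤ (≤-reflexive (sym x≡1+x')))) ∉A))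

pushDown-∈ : ∀ {n} (S : Subset² n) x y → T (pushDown S x y) → toℕ y < count (S x)
pushDown-∈ S x y ∈P = subst (toℕ y <_) (countFin≡count (S x)) (<ᵇ⇒< _ _ ∈P)

pushDown-∉ : ∀ {n} (S : Subset² n) x y → T (not (pushDown S x y)) → count (S x) ≤ toℕ y
pushDown-∉ S x y ∉P =
  subst (_≤ toℕ y) (countFin≡count (S x)) (≮⇒≥ (T-not⇒¬T ∉P ∘ <⇒<ᵇ))

pushDown-intro : ∀ {n} (S : Subset² n) x y → toℕ y < count (S x) → T (pushDown S x y)
pushDown-intro S x y y<c = <⇒<ᵇ (subst (toℕ y <_) (sym (countFin≡count (S x))) y<c)

pushDown-downClosed : ∀ {n} (S : Subset² n) → DownClosed (pushDown S)
pushDown-downClosed S x {y} {y'} y'≤y ∈P =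
  pushDown-intro S x y' (≤-<-trans y'≤y (pushDown-∈ S x y ∈P))

pushLeft-leftClosed : ∀ {n} (S : Subset² n) → LeftClosed (pushLeft S)
pushLeft-leftClosed S = pushDown-downClosed (transpose S)

pushLeft-downClosed : ∀ {n} {S : Subset² n} → DownClosed S → DownClosed (pushLeft S)
pushLeft-downClosed {S = S} downClosed x {y} {y'} y'≤y ∈P =
  pushDown-intro (transpose S) y' x (<-≤-trans (pushDown-∈ (transpose S) y x ∈P)
    (count-mono (λ x' → downClosed x' y'≤y)))

adjacent-switch-from-0 : ∀ {m} (g : Fin (suc m) → Bool) j → g fzero ≢ g j →
  ∃₂ λ k k' → toℕ k' ≡ suc (toℕ k) × g k ≢ g k'
adjacent-switch-from-0         g fzero    g₀≢gⱼ = ⊥-elim (g₀≢gⱼ refl)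
adjacent-switch-from-0 {zero}  g (fsuc ())
adjacent-switch-from-0 {suc m} g (fsuc j) g₀≢gⱼ with g fzero ≟ᵇ g (fsuc fzero)
... | no g₀≢g₁ = fzero , fsuc fzero , refl , g₀≢g₁
... | yes g₀≡g₁ with adjacent-switch-from-0 (g ∘ fsuc) j (g₀≢gⱼ ∘ trans g₀≡g₁)
...   | k , k' , k'≡1+k , gₖ≢gₖ' = fsuc k , fsuc k' , cong suc k'≡1+k , gₖ≢gₖ'

adjacent-switch : ∀ {m} (g : Fin m → Bool) i j → g i ≢ g j →
  ∃₂ λ k k' → toℕ k' ≡ suc (toℕ k) × g k ≢ g k'
adjacent-switch {suc m} g i j gᵢ≢gⱼ with g fzero ≟ᵇ g i
... | yes g₀≡gᵢ = adjacent-switch-from-0 g j (gᵢ≢gⱼ ∘ trans (sym g₀≡gᵢ))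
... | no  g₀≢gᵢ = adjacent-switch-from-0 g i g₀≢gᵢ

∂S-column-nonempty : ∀ {n} (S : Subset² n) x →
  0 < count (S x) → count (S x) < n → 0 < count (∂S S x)
∂S-column-nonempty S x 0<c c<n with 0<count⇒∃ (S x) 0<c | count<m⇒∃¬ (S x) c<n
... | i , ∈S | j , ∉S with adjacent-switch (S x) i j (T∧T-not⇒≢ ∈S ∉S)
...   | k , k' , k'≡1+k , Sₖ≢Sₖ' with S x k in Sₖ | S x k' in Sₖ'
...     | true  | true  = ⊥-elim (Sₖ≢Sₖ' refl)
...     | false | false = ⊥-elim (Sₖ≢Sₖ' refl)
...     | true  | false = T⇒0<count (∂S S x) k (∂S-intro x k (Equivalence.from T-≡ Sₖ)
                            (escapeTo x k' (up refl k'≡1+k) (Equivalence.from T-not-≡ Sₖ')))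
...     | false | true  = T⇒0<count (∂S S x) k' (∂S-intro x k' (Equivalence.from T-≡ Sₖ')
                            (escapeTo x k (down refl k'≡1+k) (Equivalence.from T-not-≡ Sₖ)))

count≤∂S+neighbour : ∀ {n} (S : Subset² n) x x' →
  (∀ y → SquareStep (toℕ x) (toℕ y) (toℕ x') (toℕ y)) →
  count (S x) ≤ count (∂S S x) + count (S x')
count≤∂S+neighbour S x x' neighbour = ≤-trans (count≤count∖+count (S x) (S x'))
  (+-monoˡ-≤ (count (S x')) (count-mono λ y ∈S∖S' →
    let ∈S , ∉S' = Equivalence.to T-∧ ∈S∖S' in
    ∂S-intro x y ∈S (escapeTo x' y (neighbour y) ∉S')))

∂S-pushDown-column-bounds : ∀ {n} (S : Subset² n) x y → T (∂S (pushDown S) x y) →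
  count (S x) ≤ count (∂S S x) + toℕ y × toℕ y < count (S x)
∂S-pushDown-column-bounds {n} S x y ∈∂P with ∂S-elim x y ∈∂P
... | ∈P , escapeTo x' y' step ∉P = lower step , y<c
  where
  c = count (S x)
  L = count (∂S S x)

  y<c : toℕ y < c
  y<c = pushDown-∈ S x y ∈P

  c'≤y' : count (S x') ≤ toℕ y'
  c'≤y' = pushDown-∉ S x' y' ∉P

  c≤y'-if-same-column : toℕ x' ≡ toℕ x → c ≤ toℕ y'
  c≤y'-if-same-column x'≡x = subst (λ z → count (S z) ≤ toℕ y') (toℕ-injective x'≡x) c'≤y'

  lower : SquareStep (toℕ x) (toℕ y) (toℕ x') (toℕ y') → c ≤ L + toℕ y
  lower (right x'≡1+x y'≡y) = ≤-trans (count≤∂S+neighbour S x x' (λ _ → right x'≡1+x refl))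
    (+-monoʳ-≤ L (subst (count (S x') ≤_) y'≡y c'≤y'))
  lower (left x≡1+x' y≡y') = ≤-trans (count≤∂S+neighbour S x x' (λ _ → left x≡1+x' refl))
    (+-monoʳ-≤ L (subst (count (S x') ≤_) (sym y≡y') c'≤y'))
  lower (up x'≡x y'≡1+y) = begin
    c           ≡⟨ c≡1+y ⟩
    1 + toℕ y   ≤⟨ +-monoˡ-≤ (toℕ y) (∂S-column-nonempty S x 0<c c<n) ⟩
    L + toℕ y   ∎
    where
    open ≤-Reasoning
    c≡1+y : c ≡ suc (toℕ y)
    c≡1+y = ≤-antisym (subst (c ≤_) y'≡1+y (c≤y'-if-same-column x'≡x)) y<c
    0<c : 0 < c
    0<c = ≤-<-trans z≤n y<c
    c<n : c < n
    c<n = subst (_< n) (trans y'≡1+y (sym c≡1+y)) (toℕ<n y')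
  lower (down x'≡x y≡1+y') = ⊥-elim (<-irrefl refl (begin-strict
    c           ≤⟨ c≤y'-if-same-column x'≡x ⟩
    toℕ y'      <⟨ ≤-reflexive (sym y≡1+y') ⟩
    toℕ y       <⟨ y<c ⟩
    c           ∎))
    where open ≤-Reasoning

∂S-pushDown-column : ∀ {n} (S : Subset² n) x → count (∂S (pushDown S) x) ≤ count (∂S S x)
∂S-pushDown-column S x = ≤-trans (count≤width (∂S (pushDown S) x) (c ∸ L) c bounds)
  (m≤n+o⇒m∸n≤o c (c ∸ L) (subst (c ≤_) (+-comm L (c ∸ L)) (m≤n+m∸n c L)))
  where
  c = count (S x)
  L = count (∂S S x)

  bounds : ∀ y → T (∂S (pushDown S) x y) → c ∸ L ≤ toℕ y × toℕ y < c
  bounds y ∈∂P with ∂S-pushDown-column-bounds S x y ∈∂P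
  ... | c≤L+y , y<c = m≤n+o⇒m∸n≤o c L c≤L+y , y<c

card²-∂S-pushDown : ∀ {n} (S : Subset² n) → card² (∂S (pushDown S)) ≤ card² (∂S S)
card²-∂S-pushDown S = card²-mono-columns (∂S-pushDown-column S)

card²-∂S-pushLeft : ∀ {n} (S : Subset² n) → card² (∂S (pushLeft S)) ≤ card² (∂S S)
card²-∂S-pushLeft S = begin
  card² (∂S (pushLeft S))                          ≤⟨ card²-mono (∂S-transpose {A = P}) ⟩
  card² (transpose (∂S P))                         ≡⟨ card²-transpose (∂S P) ⟩
  card² (∂S P)                                     ≤⟨ card²-∂S-pushDown (transpose S) ⟩
  card² (∂S (transpose S))                         ≤⟨ card²-mono (∂S-transpose {A = S}) ⟩
  card² (transpose (∂S S))                         ≡⟨ card²-transpose (∂S S) ⟩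
  card² (∂S S)                                     ∎
  where
  open ≤-Reasoning
  P = pushDown (transpose S)

mainTheorem9 : (n : ℕ) → 1 ≤ n → (S : Subset² n) →
    card² (∂R (fallDown S)) ≤ card² (∂R S)
mainTheorem9 n _ S = begin
  card² (∂R (fallDown S))  ≤⟨ card²-mono (∂R⊆∂S fallDown-downClosed fallDown-leftClosed) ⟩
  card² (∂S (fallDown S))  ≤⟨ card²-∂S-pushLeft (pushDown S) ⟩
  card² (∂S (pushDown S))  ≤⟨ card²-∂S-pushDown S ⟩
  card² (∂S S)             ≤⟨ card²-mono (∂S⊆∂R {A = S}) ⟩
  card² (∂R S)             ∎
  where
  open ≤-Reasoning
  fallDown-downClosed : DownClosed (fallDown S)
  fallDown-downClosed = pushLeft-downClosed (pushDown-downClosed S)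
  fallDown-leftClosed : LeftClosed (fallDown S)
  fallDown-leftClosed = pushLeft-leftClosed (pushDown S)
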